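{- Let $p,q$ be integers with $2q\le p\le \frac{5}{2}q$, let $m_{p,q}$ and a witness $\widehat{T}$ be as defined below, and let $\widehat{W}^*$ be obtained from $\widehat{W}'$ by completing each of the seven triangles $wx_1x_2$, $wx_1x_5$, $wx_3x_4$, $zx_2x_3$, $tx_4x_5$, $a_1a_2a_3$, $b_1b_2b_3$ with a copy of $\widehat{T}$. Then in every balanced $(p,q)$-coloring $c$ of $\widehat{W}^*$ we have $|c(u)\cap c(v)|\le 7m_{p,q}$.
   Context: A signed graph is a graph with a signature assigning $+$ or $-$ to each edge; a cycle is negative if it has an odd number of negative edges; a vertex set is balanced if it induces no negative cycle. A balanced $(p,q)$-coloring $c$ assigns to each vertex $x$ a set $c(x)$ of $q$ colors from $\{1,\dots,p\}$ so that each color class is balanced. A color misses a set of vertices if no vertex of the set receives it. $m_{p,q}$ is the smallest integer $m$ such that there exists a planar signed simple graph $\widehat{T}$, embedded with outer face a negative triangle, such that in every balanced $(p,q)$-coloring of $\widehat{T}$ at most $m$ colors miss (the vertices of) the outer face; $\widehat{T}$ denotes such a graph attaining $m_{p,q}$. Completing a negative triangle with a copy of $\widehat{T}$ means inserting a copy of $\widehat{T}$ into the face bounded by the triangle, identifying the outer triangle of the copy with it (after switching the copy if needed so the signs agree). $\widehat{W}$ has vertices $u,v,w,z,t,x_1,\dots,x_5$ and edges $wx_i$ ($1\le i\le5$), $x_1x_2,x_2x_3,x_3x_4,x_4x_5,x_5x_1$, $zx_2,zx_3,zu,zv$, $tx_4,tx_5,tu,tv$, $ux_1,ux_2,ux_5,uv$,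 $vx_3,vx_4$; the edges $ux_2$ and $vx_4$ are positive and all others negative. $\widehat{W}'$ is obtained from $\widehat{W}$ by adding vertices $a_1,a_2,a_3$ (inside the face $ux_1x_2$) with negative edges $a_1a_2,a_2a_3,a_1a_3,a_1x_1,a_1x_2,a_2u$ and positive edges $a_2x_2,a_3u,a_3x_1$, and vertices $b_1,b_2,b_3$ (inside the face $vx_3x_4$) with negative edges $b_1b_2,b_2b_3,b_1b_3,b_1x_3,b_1x_4,b_2v$ and positive edges $b_2x_4,b_3v,b_3x_3$. -}

module Defs where

open import Data.Nat using (ℕ; zero; suc; _+_; _*_; _≤_; _<ᵇ_)
open import Data.Bool using (Bool; true; false; if_then_else_; _∧_; _∨_; not; T)
open import Data.Fin using (Fin; zero; suc; toℕ; #_; _≟_)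
open import Data.Fin.Subset using (Subset; _∈_; _∪_; ∁; ∣_∣)
open import Data.Maybe using (Maybe; just; nothing; _<∣>_) renaming (map to mapMaybe)
open import Data.List using (List; []; _∷_; length; _++_; [_])
open import Data.List.Relation.Unary.All using (All)
open import Data.List.Relation.Unary.Unique.Propositional using (Unique)
open import Data.Vec using (Vec; lookup) renaming ([] to []ᵥ; _∷_ to _∷ᵥ_)
open import Data.Product using (Σ; ∃; _×_; _,_; proj₁)
open import Data.Sum using (_⊎_; inj₁; inj₂)
open import Relation.Binary.PropositionalEquality using (_≡_)
open import Relation.Nullary using (¬_)
open import Relation.Nullary.Decidable using (⌊_⌋)
open import Function.Bundles using (_⇔_)

data Sign : Set where
  plus minus : Sign

infixl 7 _·_
_·_ : Sign → Sign → Sign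
plus  · s     = s
minus · plus  = minus
minus · minus = plus

Adj : Set → Set
Adj V = V → V → Maybe Sign

record IsSimple {V : Set} (E : Adj V) : Set where
  field
    symmetric   : ∀ x y → E x y ≡ E y x
    irreflexive : ∀ x → E x x ≡ nothing

IsAdj : ∀ {V : Set} → Adj V → V → V → Set
IsAdj E x y = ∃ λ s → E x y ≡ just s

walkSign : ∀ {V : Set} → Adj V → V → List V → Maybe Sign
walkSign E x [] = just plus
walkSign E x (y ∷ ys) with E x y
... | nothing = nothing
... | just s with walkSign E y ys
...   | nothing = nothing
...   | just r = just (s · r)

cycleSign : ∀ {V : Set} → Adj V → List V → Maybe Sign
cycleSign E [] = nothing
cycleSign E (x ∷ xs) = walkSign E x (xs ++ [ x ])

NegCycleIn : ∀ {V : Set} → Adj V → (V → Set) → Set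
NegCycleIn {V} E S =
  Σ (List V) λ vs → 3 ≤ length vs × Unique vs × All S vs × cycleSign E vs ≡ just minus

Balanced : ∀ {V : Set} → Adj V → (V → Set) → Set
Balanced E S = ¬ NegCycleIn E S

record BalancedColoring {V : Set} (E : Adj V) (p q : ℕ) : Set where
  field
    col      : V → Subset p
    card     : ∀ x → ∣ col x ∣ ≡ q
    balanced : ∀ (i : Fin p) → Balanced E (λ x → i ∈ col x)

-- Planarity (combinatorial: rotation systems, Heffter–Edmonds)

data Reach {V : Set} (E : Adj V) : V → V → Set where
  here : ∀ {x} → Reach E x x
  step : ∀ {x y z} → IsAdj E x y → Reach E y z → Reach E x z

iter : ∀ {A : Set} → (A → A) → ℕ → A → A
iter f zero a = a
iter f (suc k) a = f (iter f k a)

sumF : ∀ {k} → (Fin k → ℕ) → ℕ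
sumF {zero} f = 0
sumF {suc k} f = f zero + sumF (λ i → f (suc i))

countF : ∀ {k} → (Fin k → Bool) → ℕ
countF f = sumF (λ i → if f i then 1 else 0)

adjᵇ : Maybe Sign → Bool
adjᵇ nothing = false
adjᵇ (just _) = true

edgeCount : ∀ {n} → Adj (Fin n) → ℕ
edgeCount E = sumF (λ x → countF (λ y → (toℕ x <ᵇ toℕ y) ∧ adjᵇ (E x y)))

isolatedCount : ∀ {n} → Adj (Fin n) → ℕ
isolatedCount E = countF (λ x → if adjᵇ-any x then false else true)
  where
  adjᵇ-any : _ → Bool
  adjᵇ-any x = 0 <ᵇ countF (λ y → adjᵇ (E x y))

record RotationSystem {n : ℕ} (E : Adj (Fin n)) : Set where
  field
    rot        : Fin n → Fin n → Fin n
    rot-adj    : ∀ x y → IsAdj E x y → IsAdj E x (rot x y)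
    rot-cyclic : ∀ x y y' → IsAdj E x y → IsAdj E x y' →
                 ∃ λ k → iter (rot x) (suc k) y ≡ y'

-- face tracing on darts: (x , y) ↦ (y , rot y x)
faceStep : ∀ {n} {E : Adj (Fin n)} → RotationSystem E → Fin n × Fin n → Fin n × Fin n
faceStep R (x , y) = y , RotationSystem.rot R y x

HasFaceCount : ∀ {n} {E : Adj (Fin n)} → RotationSystem E → ℕ → Set
HasFaceCount {n} {E} R F =
  Σ (Fin n → Fin n → Fin F) λ face →
    (∀ i → ∃ λ x → ∃ λ y → IsAdj E x y × face x y ≡ i) ×
    (∀ x y x' y' → IsAdj E x y → IsAdj E x' y' →
       (face x y ≡ face x' y') ⇔ (∃ λ k → iter (faceStep R) k (x , y) ≡ (x' , y')))

HasComponentCount : ∀ {n} → Adj (Fin n) → ℕ → Set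
HasComponentCount {n} E C =
  Σ (Fin n → Fin C) λ comp →
    (∀ i → ∃ λ x → comp x ≡ i) ×
    (∀ x y → (comp x ≡ comp y) ⇔ Reach E x y)

-- a planar (genus 0) embedding in which o₁ o₂ o₃ bounds a face
-- (which may then be taken as the outer face).
-- Euler: n - e + f = 2C - (#isolated vertices), written without subtraction.
record PlanarWithFace {n : ℕ} (E : Adj (Fin n)) (o₁ o₂ o₃ : Fin n) : Set where
  field
    rotation   : RotationSystem E
    faces      : ℕ
    components : ℕ
    faceCount  : HasFaceCount rotation faces
    compCount  : HasComponentCount E components
    euler      : n + faces + isolatedCount E ≡ 2 * components + edgeCount E
    facial     : RotationSystem.rot rotation o₂ o₁ ≡ o₃ ×
                 RotationSystem.rot rotation o₃ o₂ ≡ o₁ ×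
                 RotationSystem.rot rotation o₁ o₃ ≡ o₂

record OuterTriGraph : Set where
  field
    n        : ℕ
    E        : Adj (Fin n)
    simple   : IsSimple E
    o₁ o₂ o₃ : Fin n
    negative : cycleSign E (o₁ ∷ o₂ ∷ o₃ ∷ []) ≡ just minus
    planar   : PlanarWithFace E o₁ o₂ o₃

  outer : Fin 3 → Fin n
  outer zero = o₁
  outer (suc zero) = o₂
  outer (suc (suc zero)) = o₃

  isInner : Fin n → Bool
  isInner x = not (⌊ x ≟ o₁ ⌋ ∨ ⌊ x ≟ o₂ ⌋ ∨ ⌊ x ≟ o₃ ⌋)

  Inner : Set
  Inner = Σ (Fin n) λ x → T (isInner x)

missing : ∀ {p q} (G : OuterTriGraph) → BalancedColoring (OuterTriGraph.E G) p q → ℕ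
missing G c = ∣ ∁ (col o₁ ∪ col o₂ ∪ col o₃) ∣
  where open OuterTriGraph G
        open BalancedColoring c

AtMostMissing : ℕ → ℕ → OuterTriGraph → ℕ → Set
AtMostMissing p q G m = ∀ (c : BalancedColoring (OuterTriGraph.E G) p q) → missing G c ≤ m

IsMpq : ℕ → ℕ → ℕ → Set
IsMpq p q m = (Σ OuterTriGraph λ G → AtMostMissing p q G m) ×
              (∀ G m' → AtMostMissing p q G m' → m ≤ m')

WV : Set
WV = Fin 16

u v w z t x₁ x₂ x₃ x₄ x₅ a₁ a₂ a₃ b₁ b₂ b₃ : WV
u = # 0
v = # 1
w = # 2
z = # 3
t = # 4
x₁ = # 5
x₂ = # 6
x₃ = # 7
x₄ = # 8
x₅ = # 9
a₁ = # 10
a₂ = # 11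
a₃ = # 12
b₁ = # 13
b₂ = # 14
b₃ = # 15

edgesW' : List (WV × WV × Sign)
edgesW' =
  -- W
  (w , x₁ , minus) ∷ (w , x₂ , minus) ∷ (w , x₃ , minus) ∷ (w , x₄ , minus) ∷ (w , x₅ , minus) ∷
  (x₁ , x₂ , minus) ∷ (x₂ , x₃ , minus) ∷ (x₃ , x₄ , minus) ∷ (x₄ , x₅ , minus) ∷ (x₅ , x₁ , minus) ∷
  (z , x₂ , minus) ∷ (z , x₃ , minus) ∷ (z , u , minus) ∷ (z , v , minus) ∷
  (t , x₄ , minus) ∷ (t , x₅ , minus) ∷ (t , u , minus) ∷ (t , v , minus) ∷
  (u , x₁ , minus) ∷ (u , x₂ , plus) ∷ (u , x₅ , minus) ∷ (u , v , minus) ∷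
  (v , x₃ , minus) ∷ (v , x₄ , plus) ∷
  -- gadget in face u x₁ x₂
  (a₁ , a₂ , minus) ∷ (a₂ , a₃ , minus) ∷ (a₁ , a₃ , minus) ∷ (a₁ , x₁ , minus) ∷ (a₁ , x₂ , minus) ∷
  (a₂ , u , minus) ∷ (a₂ , x₂ , plus) ∷ (a₃ , u , plus) ∷ (a₃ , x₁ , plus) ∷
  -- gadget in face v x₃ x₄
  (b₁ , b₂ , minus) ∷ (b₂ , b₃ , minus) ∷ (b₁ , b₃ , minus) ∷ (b₁ , x₃ , minus) ∷ (b₁ , x₄ , minus) ∷
  (b₂ , v , minus) ∷ (b₂ , x₄ , plus) ∷ (b₃ , v , plus) ∷ (b₃ , x₃ , plus) ∷ []

lookupEdge : List (WV × WV × Sign) → Adj WV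
lookupEdge [] x y = nothing
lookupEdge ((a , b , s) ∷ es) x y =
  if (⌊ a ≟ x ⌋ ∧ ⌊ b ≟ y ⌋) ∨ (⌊ a ≟ y ⌋ ∧ ⌊ b ≟ x ⌋) then just s else lookupEdge es x y

W' : Adj WV
W' = lookupEdge edgesW'

triangles : Vec (Vec WV 3) 7
triangles =
  (w ∷ᵥ x₁ ∷ᵥ x₂ ∷ᵥ []ᵥ) ∷ᵥ (w ∷ᵥ x₁ ∷ᵥ x₅ ∷ᵥ []ᵥ) ∷ᵥ (w ∷ᵥ x₃ ∷ᵥ x₄ ∷ᵥ []ᵥ) ∷ᵥ
  (z ∷ᵥ x₂ ∷ᵥ x₃ ∷ᵥ []ᵥ) ∷ᵥ (t ∷ᵥ x₄ ∷ᵥ x₅ ∷ᵥ []ᵥ) ∷ᵥ (a₁ ∷ᵥ a₂ ∷ᵥ a₃ ∷ᵥ []ᵥ) ∷ᵥ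
  (b₁ ∷ᵥ b₂ ∷ᵥ b₃ ∷ᵥ []ᵥ) ∷ᵥ []ᵥ

tri : Fin 7 → Fin 3 → WV
tri k j = lookup (lookup triangles k) j

switch : ∀ {V : Set} → (V → Sign) → Adj V → Adj V
switch σ E x y = mapMaybe (λ s → σ x · s · σ y) (E x y)

-- σ k is the switching applied to the k-th copy; it must make the outer
-- triangle of the copy agree in signs with the k-th triangle of W'
-- (the outer vertex outer j is identified with tri k j)
ValidSwitch : (G : OuterTriGraph) → (Fin 7 → Fin (OuterTriGraph.n G) → Sign) → Set
ValidSwitch G σ = ∀ k i j →
  switch (σ k) (OuterTriGraph.E G) (OuterTriGraph.outer G i) (OuterTriGraph.outer G j) ≡ W' (tri k i) (tri k j)

WStarV : OuterTriGraph → Set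
WStarV G = WV ⊎ (Fin 7 × OuterTriGraph.Inner G)

module _ (G : OuterTriGraph) (σ : Fin 7 → Fin (OuterTriGraph.n G) → Sign) where
  open OuterTriGraph G

  attach : Fin 7 → Fin n → WV → Maybe Sign
  attach k x a = att zero <∣> att (suc zero) <∣> att (suc (suc zero))
    where
    att : Fin 3 → Maybe Sign
    att j = if ⌊ a ≟ tri k j ⌋ then switch (σ k) E x (outer j) else nothing

  WStar : Adj (WStarV G)
  WStar (inj₁ a) (inj₁ b) = W' a b
  WStar (inj₁ a) (inj₂ (k , x)) = attach k (proj₁ x) a
  WStar (inj₂ (k , x)) (inj₁ a) = attach k (proj₁ x) a
  WStar (inj₂ (k , x)) (inj₂ (k' , y)) =
    if ⌊ k ≟ k' ⌋ then switch (σ k) E (proj₁ x) (proj₁ y) else nothing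

{-# OPTIONS --safe #-}
-- A colour i shared by u and v has a balanced colour class containing u and v.
-- The negative cycles of W′ through u and v (the triangles u v z and u v t, the
-- 4-cycles u x₂ x₃ v and u x₅ x₄ v, and a few more through w, x₁ and the two
-- gadgets) leave the class no room: it misses all three vertices of one of the
-- seven completed triangles. Every completed triangle carries a switched copy of
-- G, to which the colouring restricts, so at most m colours miss that triangle,
-- and therefore at most 7m colours are shared by u and v.
module Submission where

open import Defs
open import Data.Bool using (T; true; not; _∨_; if_then_else_)
open import Data.Empty using (⊥-elim)
open import Data.Fin using (Fin; zero; suc; #_; _≟_)
open import Data.Fin.Properties using (all?)
open import Data.Fin.Subset
  using (Subset; inside; outside; _∪_; _∩_; _⊆_; ∁; ⋃; ∣_∣; _∈_; _∉_)
open import Data.Fin.Subset.Properties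
  using (∣⊥∣≡0; p⊆q⇒∣p∣≤∣q∣; x∈p∩q⁻; x∈p∪q⁻; x∈p∪q⁺; x∉p⇒x∈∁p; _∈?_)
open import Data.List using (List; []; _∷_; _++_; [_]; map; length; tabulate)
open import Data.List.Properties using (map-++; length-map)
open import Data.List.Relation.Unary.All using (All; []; _∷_)
import Data.List.Relation.Unary.All.Properties as All
open import Data.List.Relation.Unary.Any using (Any; here; there)
import Data.List.Relation.Unary.Any.Properties as Any
open import Data.List.Relation.Unary.Unique.DecPropositional (_≟_ {16}) using (unique?)
import Data.List.Relation.Unary.Unique.Propositional.Properties as Unique
open import Data.Maybe using (Maybe; just; nothing; zipWith; _<∣>_) renaming (map to mapMaybe)
open import Data.Maybe.Properties using (<∣>-identityʳ)
open import Data.Nat using (ℕ; _+_; _*_; _≤_; _≤?_; z≤n; s≤s)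
open import Data.Nat.Properties
  using (≤-trans; ≤-reflexive; +-suc; +-monoʳ-≤; +-mono-≤; n≤1+n; module ≤-Reasoning)
open import Data.Product using (∃; _×_; _,_; proj₁; proj₂)
open import Data.Sum using (inj₁; inj₂; [_,_]′)
open import Data.Sum.Properties using (inj₁-injective)
open import Data.Unit using (tt)
open import Data.Vec using ([]; _∷_)
open import Function using (_∘_)
open import Function.Definitions using (Injective)
open import Relation.Binary.PropositionalEquality
  using (_≡_; _≢_; refl; sym; trans; cong; cong₂; subst; module ≡-Reasoning)
open import Relation.Nullary using (¬_; Dec; yes; no)
open import Relation.Nullary.Decidable
  using (⌊_⌋; True; toWitness; isYes≗does; dec-true; _→-dec_)
open import Relation.Unary using (Decidable)

·-identityʳ : ∀ s → s · plus ≡ s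
·-identityʳ plus  = refl
·-identityʳ minus = refl

·-assoc : ∀ r s t → r · s · t ≡ r · (s · t)
·-assoc plus  s     t     = refl
·-assoc minus plus  t     = refl
·-assoc minus minus plus  = refl
·-assoc minus minus minus = refl

·-comm : ∀ r s → r · s ≡ s · r
·-comm plus  s     = sym (·-identityʳ s)
·-comm minus plus  = refl
·-comm minus minus = refl

·-self : ∀ s → s · s ≡ plus
·-self plus  = refl
·-self minus = refl

·-conjugate : ∀ a s → a · s · a ≡ s
·-conjugate plus  s     = ·-identityʳ s
·-conjugate minus plus  = refl
·-conjugate minus minus = refl

·-conjugate-swap : ∀ a s b → a · s · b ≡ b · s · a
·-conjugate-swap a s b = begin
  a · s · b    ≡⟨ ·-comm (a · s) b ⟩
  b · (a · s)  ≡⟨ cong (b ·_) (·-comm a s) ⟩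
  b · (s · a)  ≡⟨ sym (·-assoc b s a) ⟩
  b · s · a    ∎
  where open ≡-Reasoning

·-cancel-middle : ∀ r s t → (r · s) · (s · t) ≡ r · t
·-cancel-middle r s t = begin
  (r · s) · (s · t)  ≡⟨ ·-assoc r s (s · t) ⟩
  r · (s · (s · t))  ≡⟨ cong (r ·_) (sym (·-assoc s s t)) ⟩
  r · (s · s · t)    ≡⟨ cong (λ x → r · (x · t)) (·-self s) ⟩
  r · t              ∎
  where open ≡-Reasoning

·-switch-compose : ∀ a s b r c → (a · s · b) · (b · r · c) ≡ a · (s · r) · c
·-switch-compose a s b r c = begin
  (a · s · b) · (b · r · c)    ≡⟨ cong ((a · s · b) ·_) (·-assoc b r c) ⟩
  (a · s · b) · (b · (r · c))  ≡⟨ ·-cancel-middle (a · s) b (r · c) ⟩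
  a · s · (r · c)              ≡⟨ ·-assoc a s (r · c) ⟩
  a · (s · (r · c))            ≡⟨ cong (a ·_) (sym (·-assoc s r c)) ⟩
  a · (s · r · c)              ≡⟨ sym (·-assoc a (s · r) c) ⟩
  a · (s · r) · c              ∎
  where open ≡-Reasoning

walkSign-∷ : ∀ {V : Set} (E : Adj V) x y ys →
             walkSign E x (y ∷ ys) ≡ zipWith _·_ (E x y) (walkSign E y ys)
walkSign-∷ E x y ys with E x y
... | nothing = refl
... | just s with walkSign E y ys
...   | nothing = refl
...   | just r  = refl

walkSign-switch : ∀ {V : Set} (σ : V → Sign) (E : Adj V) x ys y →
  walkSign (switch σ E) x (ys ++ [ y ]) ≡
  mapMaybe (λ s → σ x · s · σ y) (walkSign E x (ys ++ [ y ]))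
walkSign-switch σ E x [] y rewrite walkSign-∷ (switch σ E) x y [] | walkSign-∷ E x y []
  with E x y
... | nothing = refl
... | just s  rewrite ·-identityʳ s = cong just (·-identityʳ (σ x · s · σ y))
walkSign-switch σ E x (x′ ∷ ys) y
  rewrite walkSign-∷ (switch σ E) x x′ (ys ++ [ y ]) | walkSign-∷ E x x′ (ys ++ [ y ])
        | walkSign-switch σ E x′ ys y
  with E x x′ | walkSign E x′ (ys ++ [ y ])
... | nothing | _       = refl
... | just s  | nothing = refl
... | just s  | just r  = cong just (·-switch-compose (σ x) s (σ x′) r (σ y))

cycleSign-switch : ∀ {V : Set} (σ : V → Sign) (E : Adj V) vs →
                   cycleSign (switch σ E) vs ≡ cycleSign E vs
cycleSign-switch σ E []       = refl
cycleSign-switch σ E (x ∷ xs) rewrite walkSign-switch σ E x xs x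
  with walkSign E x (xs ++ [ x ])
... | nothing = refl
... | just s  = cong just (·-conjugate (σ x) s)

Balanced-switch : ∀ {V : Set} (σ : V → Sign) {E : Adj V} {S : V → Set} →
                  Balanced (switch σ E) S → Balanced E S
Balanced-switch σ {E} balanced (vs , long , distinct , inS , negative) =
  balanced (vs , long , distinct , inS , trans (cycleSign-switch σ E vs) negative)

module _ {A B : Set} {E₁ : Adj A} {E₂ : Adj B} (f : A → B)
         (f-preserves : ∀ x y → E₂ (f x) (f y) ≡ E₁ x y) where

  walkSign-map : ∀ x ys → walkSign E₂ (f x) (map f ys) ≡ walkSign E₁ x ys
  walkSign-map x []       = refl
  walkSign-map x (y ∷ ys)
    rewrite walkSign-∷ E₂ (f x) (f y) (map f ys) | walkSign-∷ E₁ x y ys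
          | f-preserves x y | walkSign-map y ys = refl

  cycleSign-map : ∀ vs → cycleSign E₂ (map f vs) ≡ cycleSign E₁ vs
  cycleSign-map []       = refl
  cycleSign-map (x ∷ xs) rewrite sym (map-++ f xs [ x ]) = walkSign-map x (xs ++ [ x ])

  Balanced-pullback : Injective _≡_ _≡_ f → {S : B → Set} → Balanced E₂ S → Balanced E₁ (S ∘ f)
  Balanced-pullback f-injective balanced (vs , long , distinct , inS , negative) =
    balanced ( map f vs
             , subst (3 ≤_) (sym (length-map f vs)) long
             , Unique.map⁺ f-injective distinct
             , All.map⁺ inS
             , trans (cycleSign-map vs) negative )

balancedColoring-pullback :
  ∀ {A B : Set} {E₁ : Adj A} {E₂ : Adj B} {p q : ℕ} (f : A → B) (σ : A → Sign) →
  Injective _≡_ _≡_ f → (∀ x y → E₂ (f x) (f y) ≡ switch σ E₁ x y) →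
  BalancedColoring E₂ p q → BalancedColoring E₁ p q
balancedColoring-pullback f σ f-injective f-preserves c = record
  { col      = col ∘ f
  ; card     = card ∘ f
  ; balanced = λ i → Balanced-switch σ (Balanced-pullback f f-preserves f-injective (balanced i))
  }
  where open BalancedColoring c

module _ {V : Set} {E : Adj V} (simple : IsSimple E) where
  open IsSimple simple

  walkSign-repeat : ∀ x ys → walkSign E x (x ∷ ys) ≡ nothing
  walkSign-repeat x ys rewrite walkSign-∷ E x x ys | irreflexive x = refl

  walkSign-undefined-tail : ∀ x y ys → walkSign E y ys ≡ nothing →
                            walkSign E x (y ∷ ys) ≡ nothing
  walkSign-undefined-tail x y ys undefined rewrite walkSign-∷ E x y ys | undefined
    with E x y
  ... | nothing = refl
  ... | just _  = refl

  triangle-distinct : ∀ {a b c s} → cycleSign E (a ∷ b ∷ c ∷ []) ≡ just s →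
                      a ≢ b × b ≢ c × c ≢ a
  triangle-distinct {a} {b} {c} {s} signed = a≢b , b≢c , c≢a
    where
    nothing≢just : ∀ {w} → w ≡ nothing → w ≢ just s
    nothing≢just refl ()

    a≢b : a ≢ b
    a≢b refl = nothing≢just (walkSign-repeat a _) signed
    b≢c : b ≢ c
    b≢c refl = nothing≢just (walkSign-undefined-tail a b _ (walkSign-repeat b _)) signed
    c≢a : c ≢ a
    c≢a refl = nothing≢just
      (walkSign-undefined-tail a b _ (walkSign-undefined-tail b c _ (walkSign-repeat c _))) signed

∣p∪q∣≤∣p∣+∣q∣ : ∀ {n} (p q : Subset n) → ∣ p ∪ q ∣ ≤ ∣ p ∣ + ∣ q ∣
∣p∪q∣≤∣p∣+∣q∣ []            []            = z≤n
∣p∪q∣≤∣p∣+∣q∣ (inside  ∷ p) (inside  ∷ q) =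
  s≤s (≤-trans (∣p∪q∣≤∣p∣+∣q∣ p q) (+-monoʳ-≤ ∣ p ∣ (n≤1+n ∣ q ∣)))
∣p∪q∣≤∣p∣+∣q∣ (inside  ∷ p) (outside ∷ q) = s≤s (∣p∪q∣≤∣p∣+∣q∣ p q)
∣p∪q∣≤∣p∣+∣q∣ (outside ∷ p) (inside  ∷ q) =
  ≤-trans (s≤s (∣p∪q∣≤∣p∣+∣q∣ p q)) (≤-reflexive (sym (+-suc ∣ p ∣ ∣ q ∣)))
∣p∪q∣≤∣p∣+∣q∣ (outside ∷ p) (outside ∷ q) = ∣p∪q∣≤∣p∣+∣q∣ p q

∣⋃∣≤length*bound : ∀ {n m} (ps : List (Subset n)) → All (λ p → ∣ p ∣ ≤ m) ps →
                   ∣ ⋃ ps ∣ ≤ length ps * m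
∣⋃∣≤length*bound {n} []       []       = ≤-reflexive (∣⊥∣≡0 n)
∣⋃∣≤length*bound     (p ∷ ps) (h ∷ hs) =
  ≤-trans (∣p∪q∣≤∣p∣+∣q∣ p (⋃ ps)) (+-mono-≤ h (∣⋃∣≤length*bound ps hs))

x∈⋃⁺ : ∀ {n} {x : Fin n} {ps : List (Subset n)} → Any (x ∈_) ps → x ∈ ⋃ ps
x∈⋃⁺ (here x∈p)    = x∈p∪q⁺ (inj₁ x∈p)
x∈⋃⁺ (there x∈⋃ps) = x∈p∪q⁺ (inj₂ (x∈⋃⁺ x∈⋃ps))

x∉p∪q∪r⇒x∈∁ : ∀ {n} {x : Fin n} {p q r : Subset n} →
              x ∉ p → x ∉ q → x ∉ r → x ∈ ∁ (p ∪ q ∪ r)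
x∉p∪q∪r⇒x∈∁ {p = p} {q} {r} x∉p x∉q x∉r =
  x∉p⇒x∈∁p ([ x∉p , [ x∉q , x∉r ]′ ∘ x∈p∪q⁻ q r ]′ ∘ x∈p∪q⁻ p (q ∪ r))

missingColors : ∀ {V : Set} {E : Adj V} {p q} → BalancedColoring E p q → (Fin 3 → V) → Subset p
missingColors c t = ∁ (col (t zero) ∪ col (t (suc zero)) ∪ col (t (suc (suc zero))))
  where open BalancedColoring c

missingColors-cong : ∀ {V : Set} {E : Adj V} {p q} (c : BalancedColoring E p q) {s t : Fin 3 → V} →
                     (∀ j → s j ≡ t j) → missingColors c s ≡ missingColors c t
missingColors-cong c s≗t =
  cong ∁ (cong₂ _∪_ (cong col (s≗t zero))
                    (cong₂ _∪_ (cong col (s≗t (suc zero))) (cong col (s≗t (suc (suc zero))))))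
  where open BalancedColoring c

⌊≟-refl⌋ : ∀ {m} (x : Fin m) → ⌊ x ≟ x ⌋ ≡ true
⌊≟-refl⌋ x = trans (isYes≗does (x ≟ x)) (dec-true (x ≟ x) refl)

module _ {m} {A : Set} (b : Fin 3 → Fin m) (b-injective : ∀ {i j} → b i ≡ b j → i ≡ j) where

  ⌊≟⌋-injective : ∀ i j → ⌊ b i ≟ b j ⌋ ≡ ⌊ i ≟ j ⌋
  ⌊≟⌋-injective i j with b i ≟ b j | i ≟ j
  ... | yes _  | yes _    = refl
  ... | no _   | no _     = refl
  ... | yes e  | no i≢j   = ⊥-elim (i≢j (b-injective e))
  ... | no b≢b | yes refl = ⊥-elim (b≢b refl)

  guarded-lookup : ∀ (f : Fin 3 → Maybe A) i →
    (if ⌊ b i ≟ b zero ⌋ then f zero else nothing) <∣>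
    (if ⌊ b i ≟ b (suc zero) ⌋ then f (suc zero) else nothing) <∣>
    (if ⌊ b i ≟ b (suc (suc zero)) ⌋ then f (suc (suc zero)) else nothing) ≡ f i
  guarded-lookup f i
    rewrite ⌊≟⌋-injective i zero | ⌊≟⌋-injective i (suc zero) | ⌊≟⌋-injective i (suc (suc zero))
    with i
  ... | zero           = <∣>-identityʳ (f zero)
  ... | suc zero       = <∣>-identityʳ (f (suc zero))
  ... | suc (suc zero) = refl

tri-injective : ∀ k {i j} → tri k i ≡ tri k j → i ≡ j
tri-injective k {i} {j} = toWitness {a? = distinct?} _ k i j
  where
  distinct? : Dec (∀ k i j → tri k i ≡ tri k j → i ≡ j)
  distinct? = all? λ k → all? λ i → all? λ j → (tri k i ≟ tri k j) →-dec (i ≟ j)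

wx₁x₂ wx₁x₅ wx₃x₄ zx₂x₃ tx₄x₅ a₁a₂a₃ b₁b₂b₃ : Fin 7
wx₁x₂  = # 0
wx₁x₅  = # 1
wx₃x₄  = # 2
zx₂x₃  = # 3
tx₄x₅  = # 4
a₁a₂a₃ = # 5
b₁b₂b₃ = # 6

MissesTriangle : (WV → Set) → Set
MissesTriangle S = ∃ λ k → ∀ j → ¬ S (tri k j)

module _ {S : WV → Set} (S? : Decidable S) (balanced : Balanced W' S) (Su : S u) (Sv : S v) where

  private
    notNegative : (vs : List WV) {long : True (3 ≤? length vs)} {distinct : True (unique? vs)} →
                  cycleSign W' vs ≡ just minus → ¬ All S vs
    notNegative vs {long} {distinct} negative inS =
      balanced (vs , toWitness long , toWitness distinct , inS , negative)

    misses : ∀ k → ¬ S (tri k zero) → ¬ S (tri k (suc zero)) → ¬ S (tri k (suc (suc zero))) →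
             MissesTriangle S
    misses k ∉₀ ∉₁ ∉₂ = k , λ { zero → ∉₀ ; (suc zero) → ∉₁ ; (suc (suc zero)) → ∉₂ }

    x₂x₄-case : S x₂ → S x₄ → ¬ S x₅ → MissesTriangle S
    x₂x₄-case Sx₂ Sx₄ x₅∉ with S? w | S? x₁
    ... | yes Sw | _      =
      ⊥-elim (notNegative (u ∷ x₂ ∷ w ∷ x₄ ∷ v ∷ []) refl (Su ∷ Sx₂ ∷ Sw ∷ Sx₄ ∷ Sv ∷ []))
    ... | no w∉  | no x₁∉ = misses wx₁x₅ w∉ x₁∉ x₅∉
    ... | no _   | yes Sx₁ with S? a₁ | S? a₂ | S? a₃
    ...   | yes Sa₁ | _       | _       =
      ⊥-elim (notNegative (a₁ ∷ x₁ ∷ x₂ ∷ []) refl (Sa₁ ∷ Sx₁ ∷ Sx₂ ∷ []))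
    ...   | no _    | yes Sa₂ | _       =
      ⊥-elim (notNegative (a₂ ∷ u ∷ x₂ ∷ []) refl (Sa₂ ∷ Su ∷ Sx₂ ∷ []))
    ...   | no _    | no _    | yes Sa₃ =
      ⊥-elim (notNegative (a₃ ∷ u ∷ x₁ ∷ []) refl (Sa₃ ∷ Su ∷ Sx₁ ∷ []))
    ...   | no a₁∉  | no a₂∉  | no a₃∉  = misses a₁a₂a₃ a₁∉ a₂∉ a₃∉

    x₂x₅-case : S x₂ → ¬ S x₃ → ¬ S x₄ → S x₅ → MissesTriangle S
    x₂x₅-case Sx₂ x₃∉ x₄∉ Sx₅ with S? w
    ... | yes Sw =
      ⊥-elim (notNegative (u ∷ x₂ ∷ w ∷ x₅ ∷ []) refl (Su ∷ Sx₂ ∷ Sw ∷ Sx₅ ∷ []))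
    ... | no w∉  = misses wx₃x₄ w∉ x₃∉ x₄∉

    x₃x₄-case : S x₃ → S x₄ → MissesTriangle S
    x₃x₄-case Sx₃ Sx₄ with S? b₁ | S? b₂ | S? b₃
    ... | yes Sb₁ | _       | _       =
      ⊥-elim (notNegative (b₁ ∷ x₃ ∷ x₄ ∷ []) refl (Sb₁ ∷ Sx₃ ∷ Sx₄ ∷ []))
    ... | no _    | yes Sb₂ | _       =
      ⊥-elim (notNegative (b₂ ∷ v ∷ x₄ ∷ []) refl (Sb₂ ∷ Sv ∷ Sx₄ ∷ []))
    ... | no _    | no _    | yes Sb₃ =
      ⊥-elim (notNegative (b₃ ∷ v ∷ x₃ ∷ []) refl (Sb₃ ∷ Sv ∷ Sx₃ ∷ []))
    ... | no b₁∉  | no b₂∉  | no b₃∉  = misses b₁b₂b₃ b₁∉ b₂∉ b₃∉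

    x₃x₅-case : ¬ S x₂ → S x₃ → S x₅ → MissesTriangle S
    x₃x₅-case x₂∉ Sx₃ Sx₅ with S? w | S? x₁
    ... | yes Sw | _       =
      ⊥-elim (notNegative (u ∷ v ∷ x₃ ∷ w ∷ x₅ ∷ []) refl (Su ∷ Sv ∷ Sx₃ ∷ Sw ∷ Sx₅ ∷ []))
    ... | no _   | yes Sx₁ =
      ⊥-elim (notNegative (u ∷ x₁ ∷ x₅ ∷ []) refl (Su ∷ Sx₁ ∷ Sx₅ ∷ []))
    ... | no w∉  | no x₁∉  = misses wx₁x₂ w∉ x₁∉ x₂∉

  balanced∋uv⇒missesTriangle : MissesTriangle S
  balanced∋uv⇒missesTriangle with S? z | S? t
  ... | yes Sz | _      = ⊥-elim (notNegative (u ∷ v ∷ z ∷ []) refl (Su ∷ Sv ∷ Sz ∷ []))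
  ... | no _   | yes St = ⊥-elim (notNegative (u ∷ v ∷ t ∷ []) refl (Su ∷ Sv ∷ St ∷ []))
  ... | no z∉  | no t∉ with S? x₂ | S? x₃ | S? x₄ | S? x₅
  ...   | no x₂∉  | no x₃∉  | _       | _       = misses zx₂x₃ z∉ x₂∉ x₃∉
  ...   | _       | _       | no x₄∉  | no x₅∉  = misses tx₄x₅ t∉ x₄∉ x₅∉
  ...   | yes Sx₂ | yes Sx₃ | _       | _       =
    ⊥-elim (notNegative (u ∷ x₂ ∷ x₃ ∷ v ∷ []) refl (Su ∷ Sx₂ ∷ Sx₃ ∷ Sv ∷ []))
  ...   | _       | _       | yes Sx₄ | yes Sx₅ =
    ⊥-elim (notNegative (u ∷ x₅ ∷ x₄ ∷ v ∷ []) refl (Su ∷ Sx₅ ∷ Sx₄ ∷ Sv ∷ []))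
  ...   | yes Sx₂ | no _    | yes Sx₄ | no x₅∉  = x₂x₄-case Sx₂ Sx₄ x₅∉
  ...   | yes Sx₂ | no x₃∉  | no x₄∉  | yes Sx₅ = x₂x₅-case Sx₂ x₃∉ x₄∉ Sx₅
  ...   | no _    | yes Sx₃ | yes Sx₄ | no _    = x₃x₄-case Sx₃ Sx₄
  ...   | no x₂∉  | yes Sx₃ | no _    | yes Sx₅ = x₃x₅-case x₂∉ Sx₃ Sx₅

module Copy (G : OuterTriGraph) (σ : Fin 7 → Fin (OuterTriGraph.n G) → Sign)
            (valid : ValidSwitch G σ) where
  open OuterTriGraph G
  open IsSimple simple

  outer-injective : ∀ {i j} → outer i ≡ outer j → i ≡ j
  outer-injective = injective (triangle-distinct simple negative)
    where
    injective : o₁ ≢ o₂ × o₂ ≢ o₃ × o₃ ≢ o₁ → ∀ {i j} → outer i ≡ outer j → i ≡ j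
    injective _               {zero}           {zero}           _ = refl
    injective (o₁≢o₂ , _ , _) {zero}           {suc zero}       e = ⊥-elim (o₁≢o₂ e)
    injective (_ , _ , o₃≢o₁) {zero}           {suc (suc zero)} e = ⊥-elim (o₃≢o₁ (sym e))
    injective (o₁≢o₂ , _ , _) {suc zero}       {zero}           e = ⊥-elim (o₁≢o₂ (sym e))
    injective _               {suc zero}       {suc zero}       _ = refl
    injective (_ , o₂≢o₃ , _) {suc zero}       {suc (suc zero)} e = ⊥-elim (o₂≢o₃ e)
    injective (_ , _ , o₃≢o₁) {suc (suc zero)} {zero}           e = ⊥-elim (o₃≢o₁ e)
    injective (_ , o₂≢o₃ , _) {suc (suc zero)} {suc zero}       e = ⊥-elim (o₂≢o₃ (sym e))
    injective _               {suc (suc zero)} {suc (suc zero)} _ = refl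

  -- isInner is unfolded in these two types so that `with` can abstract over its three tests.
  inner-intro : ∀ {x} → x ≢ o₁ → x ≢ o₂ → x ≢ o₃ →
                T (not (⌊ x ≟ o₁ ⌋ ∨ ⌊ x ≟ o₂ ⌋ ∨ ⌊ x ≟ o₃ ⌋))
  inner-intro {x} x≢o₁ x≢o₂ x≢o₃ with x ≟ o₁ | x ≟ o₂ | x ≟ o₃
  ... | yes e | _     | _     = x≢o₁ e
  ... | no _  | yes e | _     = x≢o₂ e
  ... | no _  | no _  | yes e = x≢o₃ e
  ... | no _  | no _  | no _  = tt

  inner-elim : ∀ {x} → T (not (⌊ x ≟ o₁ ⌋ ∨ ⌊ x ≟ o₂ ⌋ ∨ ⌊ x ≟ o₃ ⌋)) →
               x ≢ o₁ × x ≢ o₂ × x ≢ o₃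
  inner-elim {x} isInner with x ≟ o₁ | x ≟ o₂ | x ≟ o₃
  inner-elim () | yes _ | _     | _
  inner-elim () | no _  | yes _ | _
  inner-elim () | no _  | no _  | yes _
  inner-elim _  | no n₁ | no n₂ | no n₃ = n₁ , n₂ , n₃

  outer-not-inner : ∀ j → ¬ T (isInner (outer j))
  outer-not-inner zero             isInner = proj₁ (inner-elim isInner) refl
  outer-not-inner (suc zero)       isInner = proj₁ (proj₂ (inner-elim isInner)) refl
  outer-not-inner (suc (suc zero)) isInner = proj₂ (proj₂ (inner-elim isInner)) refl

  data Position (x : Fin n) : Set where
    outerAt : ∀ j → outer j ≡ x → Position x
    inner   : T (isInner x) → Position x

  position : ∀ x → Position x
  position x with x ≟ o₁ | x ≟ o₂ | x ≟ o₃
  ... | yes e | _     | _     = outerAt zero (sym e)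
  ... | no _  | yes e | _     = outerAt (suc zero) (sym e)
  ... | no _  | no _  | yes e = outerAt (suc (suc zero)) (sym e)
  ... | no n₁ | no n₂ | no n₃ = inner (inner-intro n₁ n₂ n₃)

  switch-symmetric : ∀ (τ : Fin n → Sign) x y → switch τ E x y ≡ switch τ E y x
  switch-symmetric τ x y rewrite symmetric x y with E y x
  ... | nothing = refl
  ... | just s  = cong just (·-conjugate-swap (τ x) s (τ y))

  attach-tri : ∀ k i y → attach G σ k y (tri k i) ≡ switch (σ k) E y (outer i)
  attach-tri k i y = guarded-lookup (tri k) (tri-injective k) (λ j → switch (σ k) E y (outer j)) i

  module _ (k : Fin 7) where

    place : ∀ {x} → Position x → WStarV G
    place     (outerAt j _)   = inj₁ (tri k j)
    place {x} (inner isInner) = inj₂ (k , x , isInner)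

    copy : Fin n → WStarV G
    copy x = place (position x)

    place-injective : ∀ {x y} (px : Position x) (py : Position y) → place px ≡ place py → x ≡ y
    place-injective (outerAt i refl) (outerAt j refl) e    = cong outer (tri-injective k (inj₁-injective e))
    place-injective (inner _)        (inner _)        refl = refl

    copy-injective : Injective _≡_ _≡_ copy
    copy-injective {x} {y} = place-injective (position x) (position y)

    place-preserves : ∀ {x y} (px : Position x) (py : Position y) →
                      WStar G σ (place px) (place py) ≡ switch (σ k) E x y
    place-preserves (outerAt i refl) (outerAt j refl) = sym (valid k i j)
    place-preserves (outerAt i refl) (inner _)        =
      trans (attach-tri k i _) (switch-symmetric (σ k) _ (outer i))
    place-preserves (inner _)        (outerAt j refl) = attach-tri k j _
    place-preserves (inner _)        (inner _)        =
      cong (if_then switch (σ k) E _ _ else nothing) (⌊≟-refl⌋ k)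

    copy-preserves : ∀ x y → WStar G σ (copy x) (copy y) ≡ switch (σ k) E x y
    copy-preserves x y = place-preserves (position x) (position y)

    copy-outer : ∀ j → copy (outer j) ≡ inj₁ (tri k j)
    copy-outer j with position (outer j)
    ... | outerAt i e   = cong (inj₁ ∘ tri k) (outer-injective e)
    ... | inner isInner = ⊥-elim (outer-not-inner j isInner)

    copyColoring : ∀ {p q} → BalancedColoring (WStar G σ) p q → BalancedColoring E p q
    copyColoring = balancedColoring-pullback copy (σ k) copy-injective copy-preserves

    missing-copyColoring : ∀ {p q} (c : BalancedColoring (WStar G σ) p q) →
                           missing G (copyColoring c) ≡ ∣ missingColors c (inj₁ ∘ tri k) ∣
    missing-copyColoring c = cong ∣_∣ (missingColors-cong c copy-outer)

lemma4 : ∀ (p q : ℕ) → 2 * q ≤ p → 2 * p ≤ 5 * q →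
         ∀ (m : ℕ) → IsMpq p q m →
         ∀ (G : OuterTriGraph) → AtMostMissing p q G m →
         ∀ (σ : Fin 7 → Fin (OuterTriGraph.n G) → Sign) → ValidSwitch G σ →
         ∀ (c : BalancedColoring (WStar G σ) p q) →
         ∣ BalancedColoring.col c (inj₁ u) ∩ BalancedColoring.col c (inj₁ v) ∣ ≤ 7 * m
lemma4 p q _ _ m _ G atMostMissing σ valid c = begin
  ∣ col (inj₁ u) ∩ col (inj₁ v) ∣  ≤⟨ p⊆q⇒∣p∣≤∣q∣ shared⊆missing ⟩
  ∣ ⋃ (tabulate missingAt) ∣       ≤⟨ ∣⋃∣≤length*bound (tabulate missingAt) (All.tabulate⁺ {f = missingAt} bound) ⟩
  7 * m                            ∎
  where
  open BalancedColoring c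
  open Copy G σ valid
  open ≤-Reasoning

  missingAt : Fin 7 → Subset p
  missingAt k = missingColors c (inj₁ ∘ tri k)

  bound : ∀ k → ∣ missingAt k ∣ ≤ m
  bound k = subst (_≤ m) (missing-copyColoring k c) (atMostMissing (copyColoring k c))

  shared⊆missing : col (inj₁ u) ∩ col (inj₁ v) ⊆ ⋃ (tabulate missingAt)
  shared⊆missing {i} i∈uv with x∈p∩q⁻ (col (inj₁ u)) (col (inj₁ v)) i∈uv
  ... | i∈u , i∈v with balanced∋uv⇒missesTriangle (λ x → i ∈? col (inj₁ x))
                         (Balanced-pullback inj₁ (λ _ _ → refl) inj₁-injective (balanced i)) i∈u i∈v
  ... | k , i∉ = x∈⋃⁺ (Any.tabulate⁺ {f = missingAt} k (x∉p∪q∪r⇒x∈∁ (i∉ zero) (i∉ (suc zero)) (i∉ (suc (suc zero)))))
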